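{- Let $\sigma$ be a homogeneous ordering in which North is the smallest direction. Then the never-go-South tree $T_{\boldsymbol{D}_H}$ is a subtree of $T_{\mathrm{saw}}^\sigma(\mathbb{Z}^2)$, i.e., every walk that is a vertex of $T_{\boldsymbol{D}_H}$ is a vertex of $T_{\mathrm{saw}}^\sigma(\mathbb{Z}^2)$.
   Context: Steps in $\mathbb{Z}^2$: $N=(0,1),S=(0,-1),E=(1,0),W=(-1,0)$. An ordering $\sigma=(\sigma_v)$ assigns to each $v\in\mathbb{Z}^2$ a total order $\sigma_v$ of its four neighbours; it is homogeneous if there is one total order on $\{N,E,S,W\}$ such that for every $v$ the neighbours $v+d$ are ordered by the order of $d$. $T_{\mathrm{saw}}(\mathbb{Z}^2)$ is the rooted tree of walks $(v_0,\dots,v_m)$ with $v_0$ the origin, $v_0,\dots,v_{m-1}$ distinct, $v_m\ne v_{m-2}$, and either $v_m$ new or $v_m=v_i$ for some $i$ (such walks are leaves); parent = walk minus its last step. A leaf $(v_0,\dots,v_i=w,v_{i+1},\dots,v_{m-1},v_m=w)$ is labelled unoccupied if $v_{i+1}>v_{m-1}$ in $\sigma_w$ and occupied if $v_{i+1}<v_{m-1}$ in $\sigma_w$. $T_{\mathrm{saw}}^\sigma(\mathbb{Z}^2)$ is obtained by deleting unoccupied leaves and, for each occupied leaf, deleting its parent with the whole subtree below it. $T_{\boldsymbol{D}_H}$ is the rooted tree of walks from the origin generated by the following rules, where each state records the last step and a vertex in a state has one child for each listed state, the child being the walk extended by the step named by the child's state: $O\to N\,|\,E\,|\,W$ (root $O$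 = origin), $N\to N\,|\,E\,|\,W$, $E\to N\,|\,E$, $W\to N\,|\,W$. Equivalently its vertices are the walks from the origin using only steps $N,E,W$ and never an $E$ step immediately followed by a $W$ step or vice versa. -}

module Defs where

open import Data.Integer using (ℤ; +_; _+_; -_)
open import Data.Nat using (ℕ; _<_; _≤_; _∸_)
open import Data.List using (List; []; _∷_; _++_; [_]; length; take; foldl; lookup)
open import Data.Product using (_×_; Σ; ∃; ∃-syntax; _,_; proj₁; proj₂)
open import Data.Unit using (⊤)
open import Relation.Binary.PropositionalEquality using (_≡_; _≢_)
open import Relation.Nullary using (¬_)

data Dir : Set where
  N E S W : Dir

Point : Set
Point = ℤ × ℤ

origin : Point
origin = (+ 0 , + 0)

step : Dir → Point
step N = (+ 0 , + 1)
step S = (+ 0 , - (+ 1))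
step E = (+ 1 , + 0)
step W = (- (+ 1) , + 0)

move : Point → Dir → Point
move (x , y) d = (x + proj₁ (step d) , y + proj₂ (step d))

-- A walk from the origin is given by its list of steps (first step first).
Walk : Set
Walk = List Dir

endpt : Walk → Point
endpt = foldl move origin

-- vertex v_k of the walk ws (meaningful for k ≤ length ws)
vtx : Walk → ℕ → Point
vtx ws k = endpt (take k ws)

-- Orderings: σ_v is a total order on the four neighbours v + d of v,
-- encoded by an injective rank function on the directions d
-- (neighbour v + d is below v + d' in σ_v iff rank v d < rank v d').

record Ordering : Set where
  field
    rank : Point → Dir → ℕ
    rank-inj : ∀ v {d d'} → rank v d ≡ rank v d' → d ≡ d'
open Ordering public

NbLess : Ordering → Point → Point → Point → Set
NbLess σ w u u' = Σ Dir λ d → Σ Dir λ d' →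
  (u ≡ move w d) × (u' ≡ move w d') × (rank σ w d < rank σ w d')

Homogeneous : Ordering → Set
Homogeneous σ = Σ (Dir → ℕ) λ ρ → ∀ v d → rank σ v d ≡ ρ d

NorthSmallest : Ordering → Set
NorthSmallest σ = ∀ v d → d ≢ N → rank σ v N < rank σ v d

InTsaw : Walk → Set
InTsaw ws =
  (∀ i j → i < length ws → j < length ws → i ≢ j → vtx ws i ≢ vtx ws j) ×
  (2 ≤ length ws → vtx ws (length ws) ≢ vtx ws (length ws ∸ 2))

IsLeaf : Walk → Set
IsLeaf ws = InTsaw ws × (∃[ i ] (i < length ws × vtx ws (length ws) ≡ vtx ws i))

OccupiedLeaf : Ordering → Walk → Set
OccupiedLeaf σ ws = InTsaw ws × (∃[ i ] (i < length ws ×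
  vtx ws (length ws) ≡ vtx ws i ×
  NbLess σ (vtx ws i) (vtx ws (Data.Nat.suc i)) (vtx ws (length ws ∸ 1))))

UnoccupiedLeaf : Ordering → Walk → Set
UnoccupiedLeaf σ ws = InTsaw ws × (∃[ i ] (i < length ws ×
  vtx ws (length ws) ≡ vtx ws i ×
  NbLess σ (vtx ws i) (vtx ws (length ws ∸ 1)) (vtx ws (Data.Nat.suc i))))

-- vertices of T_saw^σ: vertices of T_saw that are not unoccupied leaves and
-- are not in the subtree of (i.e. descendants-or-equal of) the parent of an
-- occupied leaf: no prefix p of ws (including ws) has a child p ++ [d]
-- that is an occupied leaf.
InTsawσ : Ordering → Walk → Set
InTsawσ σ ws =
  InTsaw ws × (¬ UnoccupiedLeaf σ ws) ×
  (∀ k d → k ≤ length ws → ¬ OccupiedLeaf σ (take k ws ++ [ d ]))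

data State : Set where
  O : State
  st : Dir → State

data Next : State → Dir → Set where
  O-N : Next O N
  O-E : Next O E
  O-W : Next O W
  N-N : Next (st N) N
  N-E : Next (st N) E
  N-W : Next (st N) W
  E-N : Next (st E) N
  E-E : Next (st E) E
  W-N : Next (st W) N
  W-W : Next (st W) W

DHFrom : State → Walk → Set
DHFrom s [] = ⊤
DHFrom s (d ∷ ds) = Next s d × DHFrom (st d) ds

InTDH : Walk → Set
InTDH = DHFrom O

-- Along a never-go-South walk the height never decreases, and within one row the walk moves
-- in a single horizontal direction, so its vertices are pairwise distinct; in particular it is
-- a vertex of the self-avoiding-walk tree and not a leaf. The remaining danger is a child
-- p ++ [ d ] of a prefix p that is an occupied leaf. For d ≠ S the child is either again a
-- never-go-South walk, hence no leaf, or an immediate reversal, hence not in the tree at all.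
-- For d = S the child closes a loop at w with penultimate vertex w + N, and occupancy would
-- require some neighbour of w to lie below w + N in σ_w, which North being smallest forbids.
module Submission where

open import Defs
open import Data.Integer using (ℤ; +_; _+_; 1ℤ; -1ℤ)
  renaming (_≤_ to _≤ℤ_; _<_ to _<ℤ_)
import Data.Integer.Properties as ℤ
open import Algebra.Properties.AbelianGroup ℤ.+-0-abelianGroup
  using (//-rightDividesʳ; ∙-cancelˡ)
open import Data.List using (List; []; _∷_; _++_; [_]; length; take; foldl)
open import Data.List.Properties using (length-++; ++-assoc; foldl-++; take-all)
open import Data.Nat using (ℕ; zero; suc; _≤_; _<_; _∸_; z≤n; s≤s)
open import Data.Nat.Properties
  using (≤-refl; <-irrefl; <-asym; <⇒≤; m+n∸n≡m; m≤n+m; m∸n≤m; ∸-monoʳ-<)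
open import Data.Product using (_×_; ∃₂; _,_; proj₁; proj₂)
import Data.Sum as Sum
open Sum using (_⊎_; inj₁; inj₂)
open import Data.Unit using (⊤; tt)
open import Data.Empty using (⊥-elim)
open import Relation.Binary.PropositionalEquality
  using (_≡_; _≢_; refl; sym; trans; cong; cong₂; subst; module ≡-Reasoning)
open import Relation.Nullary using (¬_)

X Y : Point → ℤ
X = proj₁
Y = proj₂

opposite : Dir → Dir
opposite N = S
opposite S = N
opposite E = W
opposite W = E

move-opposite : ∀ z d → move (move z d) (opposite d) ≡ z
move-opposite (x , y) N = cong₂ _,_ (//-rightDividesʳ (+ 0) x) (//-rightDividesʳ (+ 1) y)
move-opposite (x , y) S = cong₂ _,_ (//-rightDividesʳ (+ 0) x) (//-rightDividesʳ -1ℤ y)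
move-opposite (x , y) E = cong₂ _,_ (//-rightDividesʳ (+ 1) x) (//-rightDividesʳ (+ 0) y)
move-opposite (x , y) W = cong₂ _,_ (//-rightDividesʳ -1ℤ x) (//-rightDividesʳ (+ 0) y)

step-north : ∀ d → step d ≡ step N → d ≡ N
step-north N _ = refl
step-north E ()
step-north S ()
step-north W ()

move-north-injective : ∀ w d → move w d ≡ move w N → d ≡ N
move-north-injective (x , y) d eq =
  step-north d (cong₂ _,_ (∙-cancelˡ x _ _ (cong proj₁ eq))
                          (∙-cancelˡ y _ _ (cong proj₂ eq)))

i<i+1 : ∀ i → i <ℤ i + 1ℤ
i<i+1 i = ℤ.suc[i]≤j⇒i<j (ℤ.≤-reflexive (ℤ.+-comm 1ℤ i))

i-1<i : ∀ i → i + -1ℤ <ℤ i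
i-1<i i = ℤ.i≤pred[j]⇒i<j (ℤ.≤-reflexive (ℤ.+-comm i -1ℤ))

north-raises : ∀ q → Y q <ℤ Y (move q N)
north-raises (x , y) = i<i+1 y

east-advances : ∀ q → X q <ℤ X (move q E)
east-advances (x , y) = i<i+1 x

east-level : ∀ q → Y (move q E) ≡ Y q
east-level (x , y) = ℤ.+-identityʳ y

west-retreats : ∀ q → X (move q W) <ℤ X q
west-retreats (x , y) = i-1<i x

west-level : ∀ q → Y (move q W) ≡ Y q
west-level (x , y) = ℤ.+-identityʳ y

-- The region a never-go-South walk from q whose last step was s can still visit: it never
-- descends, and on the current row it cannot turn back after an East or West step.
Sideways : State → Point → Point → Set
Sideways (st E) q r = Y q <ℤ Y r ⊎ X q ≤ℤ X r
Sideways (st W) q r = Y q <ℤ Y r ⊎ X r ≤ℤ X q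
Sideways _      _ _ = ⊤

Reach : State → Point → Point → Set
Reach s q r = Y q ≤ℤ Y r × Sideways s q r

reach-refl : ∀ s q → Reach s q q
reach-refl (st E) q = ℤ.≤-refl , inj₂ ℤ.≤-refl
reach-refl (st W) q = ℤ.≤-refl , inj₂ ℤ.≤-refl
reach-refl O      q = ℤ.≤-refl , tt
reach-refl (st N) q = ℤ.≤-refl , tt
reach-refl (st S) q = ℤ.≤-refl , tt

sideways-above : ∀ s {q r} → Y q <ℤ Y r → Sideways s q r
sideways-above (st E) q<r = inj₁ q<r
sideways-above (st W) q<r = inj₁ q<r
sideways-above O      _   = tt
sideways-above (st N) _   = tt
sideways-above (st S) _   = tt

reach-north : ∀ s q {r} → Reach (st N) (move q N) r → Reach s q r
reach-north s q (q+N≤r , _) = ℤ.<⇒≤ q<r , sideways-above s q<r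
  where q<r = ℤ.<-≤-trans (north-raises q) q+N≤r

reach-east : ∀ q {r} → Reach (st E) (move q E) r → Reach (st E) q r
reach-east q (h , inj₁ k) =
  subst (_≤ℤ _) (east-level q) h , inj₁ (subst (_<ℤ _) (east-level q) k)
reach-east q (h , inj₂ k) =
  subst (_≤ℤ _) (east-level q) h , inj₂ (ℤ.<⇒≤ (ℤ.<-≤-trans (east-advances q) k))

reach-west : ∀ q {r} → Reach (st W) (move q W) r → Reach (st W) q r
reach-west q (h , inj₁ k) =
  subst (_≤ℤ _) (west-level q) h , inj₁ (subst (_<ℤ _) (west-level q) k)
reach-west q (h , inj₂ k) =
  subst (_≤ℤ _) (west-level q) h , inj₂ (ℤ.<⇒≤ (ℤ.≤-<-trans k (west-retreats q)))

reach-step : ∀ {s d} → Next s d → ∀ q {r} → Reach (st d) (move q d) r → Reach s q r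
reach-step O-N q {r} h = reach-north O q {r} h
reach-step N-N q {r} h = reach-north (st N) q {r} h
reach-step E-N q {r} h = reach-north (st E) q {r} h
reach-step W-N q {r} h = reach-north (st W) q {r} h
reach-step O-E q h = proj₁ (reach-east q h) , tt
reach-step N-E q h = proj₁ (reach-east q h) , tt
reach-step E-E q h = reach-east q h
reach-step O-W q h = proj₁ (reach-west q h) , tt
reach-step N-W q h = proj₁ (reach-west q h) , tt
reach-step W-W q h = reach-west q h

next-not-south : ∀ {s d} → Next s d → d ≢ S
next-not-south () refl

step-leaves-reach : ∀ q d → d ≢ S → ¬ Reach (st d) (move q d) q
step-leaves-reach q N _ (h , _)      = ℤ.≤⇒≯ h (north-raises q)
step-leaves-reach q E _ (_ , inj₁ k) = ℤ.<-irrefl (east-level q) k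
step-leaves-reach q E _ (_ , inj₂ k) = ℤ.≤⇒≯ k (east-advances q)
step-leaves-reach q W _ (_ , inj₁ k) = ℤ.<-irrefl (west-level q) k
step-leaves-reach q W _ (_ , inj₂ k) = ℤ.≤⇒≯ k (west-retreats q)
step-leaves-reach q S d≢S _          = d≢S refl

vertexFrom : Point → Walk → ℕ → Point
vertexFrom p ws k = foldl move p (take k ws)

walk-in-reach : ∀ s p ws → DHFrom s ws → ∀ k → Reach s p (vertexFrom p ws k)
walk-in-reach s p []       _        zero    = reach-refl s p
walk-in-reach s p []       _        (suc k) = reach-refl s p
walk-in-reach s p (d ∷ ds) _        zero    = reach-refl s p
walk-in-reach s p (d ∷ ds) (nx , h) (suc k) =
  reach-step nx p (walk-in-reach (st d) (move p d) ds h k)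

walk-never-returns : ∀ {s} p d ds → Next s d → DHFrom (st d) ds → ∀ k →
  p ≢ vertexFrom (move p d) ds k
walk-never-returns p d ds nx h k p≡ =
  step-leaves-reach p d (next-not-south nx)
    (subst (Reach (st d) (move p d)) (sym p≡) (walk-in-reach (st d) (move p d) ds h k))

vertexFrom-injective : ∀ s p ws → DHFrom s ws → ∀ {i j} → i ≤ length ws → j ≤ length ws →
  vertexFrom p ws i ≡ vertexFrom p ws j → i ≡ j
vertexFrom-injective s p ws       _        {zero}  {zero}  _       _       _  = refl
vertexFrom-injective s p (d ∷ ds) (nx , h) {zero}  {suc j} _       _       eq =
  ⊥-elim (walk-never-returns p d ds nx h j eq)
vertexFrom-injective s p (d ∷ ds) (nx , h) {suc i} {zero}  _       _       eq =
  ⊥-elim (walk-never-returns p d ds nx h i (sym eq))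
vertexFrom-injective s p (d ∷ ds) (nx , h) {suc i} {suc j} (s≤s i≤) (s≤s j≤) eq =
  cong suc (vertexFrom-injective (st d) (move p d) ds h i≤ j≤ eq)

dh-vtx-injective : ∀ {ws i j} → InTDH ws → i ≤ length ws → j ≤ length ws →
  vtx ws i ≡ vtx ws j → i ≡ j
dh-vtx-injective {ws} h = vertexFrom-injective O origin ws h

dh-end-fresh : ∀ {ws i} → InTDH ws → i < length ws → vtx ws (length ws) ≢ vtx ws i
dh-end-fresh h i< eq = <-irrefl (sym (dh-vtx-injective h ≤-refl (<⇒≤ i<) eq)) i<

dh-in-Tsaw : ∀ {ws} → InTDH ws → InTsaw ws
dh-in-Tsaw {ws} h = distinct , no-reversal
  where
  distinct : ∀ i j → i < length ws → j < length ws → i ≢ j → vtx ws i ≢ vtx ws j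
  distinct i j i< j< i≢j eq = i≢j (dh-vtx-injective h (<⇒≤ i<) (<⇒≤ j<) eq)
  no-reversal : 2 ≤ length ws → vtx ws (length ws) ≢ vtx ws (length ws ∸ 2)
  no-reversal 2≤ eq = <-irrefl (sym (dh-vtx-injective h ≤-refl (m∸n≤m _ 2) eq))
    (∸-monoʳ-< (s≤s z≤n) 2≤)

take-length-++ : ∀ {A : Set} (xs ys : List A) → take (length xs) (xs ++ ys) ≡ xs
take-length-++ []       ys = refl
take-length-++ (x ∷ xs) ys = cong (x ∷_) (take-length-++ xs ys)

vtx-length : ∀ ws → vtx ws (length ws) ≡ endpt ws
vtx-length ws = cong endpt (take-all (length ws) ws ≤-refl)

endpt-++ : ∀ ws vs → endpt (ws ++ vs) ≡ foldl move (endpt ws) vs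
endpt-++ = foldl-++ move origin

vtx-prefix : ∀ ws vs → vtx (ws ++ vs) (length (ws ++ vs) ∸ length vs) ≡ endpt ws
vtx-prefix ws vs =
  trans (cong (λ k → endpt (take k (ws ++ vs))) length-ws) (cong endpt (take-length-++ ws vs))
  where
  length-ws : length (ws ++ vs) ∸ length vs ≡ length ws
  length-ws = trans (cong (_∸ length vs) (length-++ ws)) (m+n∸n≡m (length ws) (length vs))

backtrack-not-in-Tsaw : ∀ ws x → ¬ InTsaw (ws ++ x ∷ opposite x ∷ [])
backtrack-not-in-Tsaw ws x (_ , no-reversal) = no-reversal two≤length returns
  where
  open ≡-Reasoning
  vs = x ∷ opposite x ∷ []
  two≤length : 2 ≤ length (ws ++ vs)
  two≤length = subst (2 ≤_) (sym (length-++ ws)) (m≤n+m 2 (length ws))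
  returns : vtx (ws ++ vs) (length (ws ++ vs)) ≡ vtx (ws ++ vs) (length (ws ++ vs) ∸ 2)
  returns = begin
    vtx (ws ++ vs) (length (ws ++ vs))         ≡⟨ vtx-length (ws ++ vs) ⟩
    endpt (ws ++ vs)                           ≡⟨ endpt-++ ws vs ⟩
    move (move (endpt ws) x) (opposite x)      ≡⟨ move-opposite (endpt ws) x ⟩
    endpt ws                                   ≡⟨ vtx-prefix ws vs ⟨
    vtx (ws ++ vs) (length (ws ++ vs) ∸ 2)     ∎

next-from-origin : ∀ d → d ≢ S → Next O d
next-from-origin N _   = O-N
next-from-origin E _   = O-E
next-from-origin W _   = O-W
next-from-origin S d≢S = ⊥-elim (d≢S refl)

next-or-opposite : ∀ x d → x ≢ S → d ≢ S → Next (st x) d ⊎ d ≡ opposite x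
next-or-opposite N N _ _ = inj₁ N-N
next-or-opposite N E _ _ = inj₁ N-E
next-or-opposite N W _ _ = inj₁ N-W
next-or-opposite E N _ _ = inj₁ E-N
next-or-opposite E E _ _ = inj₁ E-E
next-or-opposite E W _ _ = inj₂ refl
next-or-opposite W N _ _ = inj₁ W-N
next-or-opposite W E _ _ = inj₂ refl
next-or-opposite W W _ _ = inj₁ W-W
next-or-opposite S _ x≢S _   = ⊥-elim (x≢S refl)
next-or-opposite _ S _   d≢S = ⊥-elim (d≢S refl)

Backtracks : Walk → Dir → Set
Backtracks ws d = ∃₂ λ vs x → ws ≡ vs ++ [ x ] × d ≡ opposite x

dhFrom-snoc-or-backtracks : ∀ x ws d → DHFrom (st x) ws → x ≢ S → d ≢ S →
  DHFrom (st x) (ws ++ [ d ]) ⊎ Backtracks (x ∷ ws) d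
dhFrom-snoc-or-backtracks x [] d _ x≢S d≢S =
  Sum.map (_, tt) (λ d≡ → [] , x , refl , d≡) (next-or-opposite x d x≢S d≢S)
dhFrom-snoc-or-backtracks x (y ∷ ws) d (nx , h) _ d≢S =
  Sum.map (nx ,_) (λ { (vs , z , eq , d≡) → x ∷ vs , z , cong (x ∷_) eq , d≡ })
    (dhFrom-snoc-or-backtracks y ws d h (next-not-south nx) d≢S)

dh-snoc-or-backtracks : ∀ ws d → InTDH ws → d ≢ S → InTDH (ws ++ [ d ]) ⊎ Backtracks ws d
dh-snoc-or-backtracks []       d _        d≢S = inj₁ (next-from-origin d d≢S , tt)
dh-snoc-or-backtracks (x ∷ ws) d (nx , h) d≢S =
  Sum.map₁ (nx ,_) (dhFrom-snoc-or-backtracks x ws d h (next-not-south nx) d≢S)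

dh-take : ∀ s ws k → DHFrom s ws → DHFrom s (take k ws)
dh-take s []       zero    _        = tt
dh-take s []       (suc k) _        = tt
dh-take s (d ∷ ds) zero    _        = tt
dh-take s (d ∷ ds) (suc k) (nx , h) = nx , dh-take (st d) ds k h

nothing-below-north : ∀ σ → NorthSmallest σ → ∀ w u → ¬ NbLess σ w u (move w N)
nothing-below-north σ north-min w u (d , d' , _ , north≡ , d<d')
  with move-north-injective w d' (sym north≡)
... | refl = rank-not-below-north d d<d'
  where
  rank-not-below-north : ∀ d → ¬ rank σ w d < rank σ w N
  rank-not-below-north N = <-irrefl refl
  rank-not-below-north E = <-asym (north-min w E λ ())
  rank-not-below-north S = <-asym (north-min w S λ ())
  rank-not-below-north W = <-asym (north-min w W λ ())

south-child-not-occupied : ∀ σ → NorthSmallest σ → ∀ ws → ¬ OccupiedLeaf σ (ws ++ [ S ])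
south-child-not-occupied σ north-min ws (_ , i , _ , closes , below) =
  nothing-below-north σ north-min w _ (subst (NbLess σ w _) penultimate≡north below)
  where
  open ≡-Reasoning
  vs = ws ++ [ S ]
  w = vtx vs i
  penultimate≡north : vtx vs (length vs ∸ 1) ≡ move w N
  penultimate≡north = begin
    vtx vs (length vs ∸ 1)          ≡⟨ vtx-prefix ws [ S ] ⟩
    endpt ws                        ≡⟨ move-opposite (endpt ws) S ⟨
    move (move (endpt ws) S) N      ≡⟨ cong (λ v → move v N) (endpt-++ ws [ S ]) ⟨
    move (endpt vs) N               ≡⟨ cong (λ v → move v N) (vtx-length vs) ⟨
    move (vtx vs (length vs)) N     ≡⟨ cong (λ v → move v N) closes ⟩
    move w N                        ∎

non-south-child-not-occupied : ∀ σ ws d → InTDH ws → d ≢ S → ¬ OccupiedLeaf σ (ws ++ [ d ])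
non-south-child-not-occupied σ ws d h d≢S (in-Tsaw , i , i< , closes , _)
  with dh-snoc-or-backtracks ws d h d≢S
... | inj₁ h′ = dh-end-fresh h′ i< closes
... | inj₂ (vs , x , refl , refl) =
  backtrack-not-in-Tsaw vs x (subst InTsaw (++-assoc vs [ x ] [ opposite x ]) in-Tsaw)

dh-child-not-occupied : ∀ σ → NorthSmallest σ → ∀ ws d → InTDH ws →
  ¬ OccupiedLeaf σ (ws ++ [ d ])
dh-child-not-occupied σ north-min ws S _ = south-child-not-occupied σ north-min ws
dh-child-not-occupied σ _         ws N h = non-south-child-not-occupied σ ws N h λ ()
dh-child-not-occupied σ _         ws E h = non-south-child-not-occupied σ ws E h λ ()
dh-child-not-occupied σ _         ws W h = non-south-child-not-occupied σ ws W h λ ()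

lemma4 : (σ : Ordering) → Homogeneous σ → NorthSmallest σ →
    (ws : Walk) → InTDH ws → InTsawσ σ ws
lemma4 σ _ north-min ws h =
  dh-in-Tsaw h ,
  (λ { (_ , i , i< , closes , _) → dh-end-fresh h i< closes }) ,
  (λ k d _ → dh-child-not-occupied σ north-min (take k ws) d (dh-take O ws k h))
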